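{- Let $p$ be an odd prime, let $1\leq r\leq p-1$ be an integer, and put \[\gamma=\frac{p^2r+p^2+r^2-pr}{p^2(p+1)}.\] For $\varepsilon>0$ let $M_p(\varepsilon)$ be a real number such that for every real $x\geq M_p(\varepsilon)$ there is a prime $q\in(x,(1+\varepsilon)x)$ with $q\equiv -1\pmod p$, and let $M'_p(\varepsilon)$ be a real number such that for every real $x\geq M'_p(\varepsilon)$ there are at least two primes $q,q'\in(x,(1+\varepsilon)x)$ with $q\equiv q'\equiv -1\pmod p$. Then: \begin{itemize} \item[(i)] There are no positive integers $c\geq M_p\!\left(\frac{(p-r)^2}{pr(p+1)}\right)$ and $k$ with $pk+r\leq cp(1-\gamma)$ such that \[\binom{pcn}{(pk+r)n}\equiv 0\pmod{pn-1}\quad\text{for all } n\geq 1.\] \item[(ii)] If $r\leq \frac{p-3}{2}$, then there are no positive integers $k\geq 2M'_p\!\left(\frac{p-(2r+1)}{p+1}\right)$ and $c$ with $cp(1-\gamma)<pk+r<c(p-r)$ such that \[\binom{pcn}{(pk+r)n}\equiv 0\pmod{pn-1}\quad\text{for all } n\geq 1.\] \end{itemize}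
   Context: Such numbers $M_p(\varepsilon)$ and $M'_p(\varepsilon)$ exist for every prime $p$ and every $\varepsilon>0$ (a known result on primes in arithmetic progressions in short intervals); in the statement they denote any fixed choice of such numbers.
   Formalization: The numbers $M_p(\varepsilon)$ and $M'_p(\varepsilon)$, and the points $x$ in their defining properties, are rational rather than real. -}

module Defs where

open import Data.Nat as ℕ using (ℕ; suc; _≥_; _∸_; nonZero)
open import Data.Nat.Combinatorics using (_C_)
open import Data.Nat.Divisibility using (_∣_)
open import Data.Nat.Primality using (Prime)
open import Data.Integer as ℤ using (ℤ; +_)
open import Data.Rational as ℚ using (ℚ; _/_; 1ℚ)
open import Data.Product using (Σ; _×_; ∃-syntax)
open import Relation.Binary.PropositionalEquality using (_≢_)

ι : ℕ → ℚ
ι n = + n / 1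

-- γ = (p²r + p² + r² − pr) / (p²(p+1))   (denominator ≠ 0 whenever p ≥ 1; 0 otherwise, irrelevant)
γ : ℕ → ℕ → ℚ
γ p r with p ℕ.* p ℕ.* suc p
... | 0 = ℚ.0ℚ
... | suc d = (((+ (p ℕ.* p ℕ.* r)) ℤ.+ (+ (p ℕ.* p)) ℤ.+ (+ (r ℕ.* r))) ℤ.- (+ (p ℕ.* r)))
        / suc d

-- ε for part (i):  (p−r)² / (p r (p+1))   (only used for 1 ≤ r, p prime)
ε₁ : ℕ → ℕ → ℚ
ε₁ p r with p ℕ.* r ℕ.* suc p
... | 0 = ℚ.0ℚ
... | suc d = ((+ p ℤ.- + r) ℤ.* (+ p ℤ.- + r)) / suc d

ε₂ : ℕ → ℕ → ℚ
ε₂ p r = (+ p ℤ.- + (2 ℕ.* r ℕ.+ 1)) / suc p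

GoodPrimeIn : ℕ → ℚ → ℚ → ℕ → Set
GoodPrimeIn p ε x q = Prime q × p ∣ suc q × x ℚ.< ι q × ι q ℚ.< (1ℚ ℚ.+ ε) ℚ.* x

IsMp : ℕ → ℚ → ℚ → Set
IsMp p ε M = (x : ℚ) → M ℚ.≤ x → ∃[ q ] GoodPrimeIn p ε x q

IsM'p : ℕ → ℚ → ℚ → Set
IsM'p p ε M = (x : ℚ) → M ℚ.≤ x →
  ∃[ q ] ∃[ q' ] (q ≢ q' × GoodPrimeIn p ε x q × GoodPrimeIn p ε x q')

BinomDiv : ℕ → ℕ → ℕ → ℕ → Set
BinomDiv p r c k = (n : ℕ) → n ≥ 1 → (p ℕ.* n ∸ 1) ∣ ((p ℕ.* c ℕ.* n) C ((p ℕ.* k ℕ.+ r) ℕ.* n))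

-- Let q be a prime with q ≡ −1 (mod p) and write q + 1 = n p. At this n the divisibility
-- hypothesis says that q divides C(c q + c, k q + s) with s = k + r n. By Legendre's formula
-- q does not divide this binomial coefficient when s ≤ c and either c < q (no carries in base q)
-- or q ≤ k and c + 1 < 2 q (both arguments carry once, by the same amount). In (i) the prime comes
-- from (c, (1 + ε₁) c); in (ii) from (c/2, (1 + ε₂) c/2), where of two such primes one has
-- 2 q ≥ c + 2. The constants γ, ε₁, ε₂ are exactly what turns the bounds on p k + r into s ≤ c
-- and, in (ii), into q ≤ k.

module Submission where

open import Defs

module BinomialValuations where

  open import Data.Nat.Base
  open import Data.Nat.Properties
  open import Data.Nat.Divisibility
  open import Data.Nat.Primality using (Prime; euclidsLemma; prime⇒nonZero; prime⇒nonTrivial)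
  open import Data.Nat.Combinatorics using (_C_; nCk≡n!/k![n-k]!; k![n∸k]!∣n!)
  open import Data.Nat.DivMod using (m/n*n≡m)
  open import Data.Nat.Solver using (module +-*-Solver)
  open +-*-Solver using (solve; con; _:+_; _:*_; _:=_)
  open import Data.Product using (∃-syntax; _×_; _,_)
  open import Data.Sum using ([_,_]′)
  open import Relation.Binary.PropositionalEquality
  open import Relation.Nullary using (¬_)

  record Valuation (q n e : ℕ) : Set where
    constructor valuation
    field
      cofactor     : ℕ
      q∤cofactor   : ¬ q ∣ cofactor
      factorisation : n ≡ q ^ e * cofactor

  nCk*k!*[n∸k]!≡n! : ∀ {n k} → k ≤ n → (n C k) * (k ! * (n ∸ k) !) ≡ n !
  nCk*k!*[n∸k]!≡n! {n} {k} k≤n = begin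
    (n C k) * (k ! * (n ∸ k) !)       ≡⟨ cong (_* (k ! * (n ∸ k) !)) (nCk≡n!/k![n-k]! k≤n) ⟩
    n ! / (k ! * (n ∸ k) !) * (k ! * (n ∸ k) !) ≡⟨ m/n*n≡m (k![n∸k]!∣n! k≤n) ⟩
    n ! ∎
    where
    open ≡-Reasoning
    instance _ = k !* (n ∸ k) !≢0

  a*q+b≡[1+a]*q+[b∸q] : ∀ a {q b} → q ≤ b → a * q + b ≡ suc a * q + (b ∸ q)
  a*q+b≡[1+a]*q+[b∸q] a {q} {b} q≤b = begin
    a * q + b               ≡⟨ cong (a * q +_) (m+[n∸m]≡n q≤b) ⟨
    a * q + (q + (b ∸ q))   ≡⟨ +-assoc (a * q) q (b ∸ q) ⟨
    a * q + q + (b ∸ q)     ≡⟨ cong (_+ (b ∸ q)) (+-comm (a * q) q) ⟩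
    suc a * q + (b ∸ q)     ∎
    where open ≡-Reasoning

  [cq+c]∸[kq+s]≡[c∸k]q+[c∸s] : ∀ q {c k s} → k ≤ c → s ≤ c →
                               (c * q + c) ∸ (k * q + s) ≡ (c ∸ k) * q + (c ∸ s)
  [cq+c]∸[kq+s]≡[c∸k]q+[c∸s] q {c} {k} {s} k≤c s≤c = begin
    (c * q + c) ∸ (k * q + s)
      ≡⟨ cong₂ (λ x y → (x * q + y) ∸ (k * q + s)) (m+[n∸m]≡n k≤c) (m+[n∸m]≡n s≤c) ⟨
    ((k + (c ∸ k)) * q + (s + (c ∸ s))) ∸ (k * q + s)
      ≡⟨ cong (_∸ (k * q + s)) (solve 5 (λ k d q s e → (k :+ d) :* q :+ (s :+ e) := (k :* q :+ s) :+ (d :* q :+ e))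
                                          refl k (c ∸ k) q s (c ∸ s)) ⟩
    (k * q + s) + ((c ∸ k) * q + (c ∸ s)) ∸ (k * q + s)
      ≡⟨ m+n∸m≡n (k * q + s) _ ⟩
    (c ∸ k) * q + (c ∸ s) ∎
    where open ≡-Reasoning

  module _ {q : ℕ} (q-prime : Prime q) where

    private instance
      q≢0 : NonZero q
      q≢0 = prime⇒nonZero q-prime

    1<q : 1 < q
    1<q = nonTrivial⇒n>1 q {{prime⇒nonTrivial q-prime}}

    ∤-* : ∀ {m n} → ¬ q ∣ m → ¬ q ∣ n → ¬ q ∣ m * n
    ∤-* q∤m q∤n q∣mn = [ q∤m , q∤n ]′ (euclidsLemma _ _ q-prime q∣mn)

    ∤-! : ∀ {a} → a < q → ¬ q ∣ a !
    ∤-! {zero}  _   = >⇒∤ 1<q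
    ∤-! {suc a} a<q = ∤-* (>⇒∤ a<q) (∤-! (<⇒≤ a<q))

    -- The multiples of q up to a q + b are q, 2 q, …, a q.
    !-split : ∀ a {b} → b < q → ∃[ w ] (¬ q ∣ w × (a * q + b) ! ≡ q ^ a * a ! * w)
    !-split zero    {zero}  _   = 1 , >⇒∤ 1<q , refl
    !-split (suc a) {zero}  _   with !-split a {pred q} (≤-reflexive (suc-pred q))
    ... | w , q∤w , eq = w , q∤w , (begin
      (suc a * q + 0) !             ≡⟨ cong _! (trans (+-identityʳ _) last) ⟩
      suc m * m !                   ≡⟨ cong₂ _*_ (sym last) eq ⟩
      suc a * q * (q ^ a * a ! * w) ≡⟨ solve 5 (λ s q x y w → s :* q :* (x :* y :* w) := q :* x :* (s :* y) :* w)
                                             refl (suc a) q (q ^ a) (a !) w ⟩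
      q * q ^ a * (suc a * a !) * w ∎)
      where
      open ≡-Reasoning
      m = a * q + pred q
      last : suc a * q ≡ suc m
      last = begin
        q + a * q           ≡⟨ +-comm q (a * q) ⟩
        a * q + q           ≡⟨ cong (a * q +_) (suc-pred q) ⟨
        a * q + suc (pred q) ≡⟨ +-suc (a * q) (pred q) ⟩
        suc m ∎
    !-split a {suc b} b<q with !-split a {b} (<⇒≤ b<q)
    ... | w , q∤w , eq = suc (a * q + b) * w , ∤-* q∤next q∤w , (begin
      (a * q + suc b) !                     ≡⟨ cong _! (+-suc (a * q) b) ⟩
      suc (a * q + b) * (a * q + b) !       ≡⟨ cong (suc (a * q + b) *_) eq ⟩
      suc (a * q + b) * (q ^ a * a ! * w)   ≡⟨ solve 4 (λ s x y w → s :* (x :* y :* w) := x :* y :* (s :* w))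
                                                     refl (suc (a * q + b)) (q ^ a) (a !) w ⟩
      q ^ a * a ! * (suc (a * q + b) * w)   ∎)
      where
      open ≡-Reasoning
      q∤next : ¬ q ∣ suc (a * q + b)
      q∤next q∣ = >⇒∤ b<q (∣m+n∣m⇒∣n (subst (q ∣_) (sym (+-suc (a * q) b)) q∣) (n∣m*n a))

    Valuation-! : ∀ a {b} e → b < q → Valuation q (a !) e → Valuation q ((a * q + b) !) (a + e)
    Valuation-! a {b} e b<q (valuation u q∤u a!≡) with !-split a b<q
    ... | w , q∤w , eq = valuation (u * w) (∤-* q∤u q∤w) (begin
      (a * q + b) !            ≡⟨ eq ⟩
      q ^ a * a ! * w          ≡⟨ cong (λ x → q ^ a * x * w) a!≡ ⟩
      q ^ a * (q ^ e * u) * w  ≡⟨ solve 4 (λ x y u w → x :* (y :* u) :* w := x :* y :* (u :* w)) refl (q ^ a) (q ^ e) u w ⟩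
      q ^ a * q ^ e * (u * w)  ≡⟨ cong (_* (u * w)) (^-distribˡ-+-* q a e) ⟨
      q ^ (a + e) * (u * w)    ∎)
      where open ≡-Reasoning

    Valuation-!-<q : ∀ {a} → a < q → Valuation q (a !) 0
    Valuation-!-<q {a} a<q = valuation (a !) (∤-! a<q) (sym (*-identityˡ (a !)))

    Valuation-!-digits : ∀ {a b} → a < q → b < q → Valuation q ((a * q + b) !) a
    Valuation-!-digits {a} a<q b<q =
      subst (Valuation q _) (+-identityʳ a) (Valuation-! a 0 b<q (Valuation-!-<q a<q))

    Valuation-!-<2q : ∀ {a} → q ≤ a → a < q + q → Valuation q (a !) 1
    Valuation-!-<2q {a} q≤a a<2q = subst (λ n → Valuation q (n !) 1) a≡q+[a∸q]
      (Valuation-! 1 0 a∸q<q (Valuation-!-<q 1<q))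
      where
      a≡q+[a∸q] : 1 * q + (a ∸ q) ≡ a
      a≡q+[a∸q] = trans (cong (_+ (a ∸ q)) (*-identityˡ q)) (m+[n∸m]≡n q≤a)
      a∸q<q : a ∸ q < q
      a∸q<q = subst (a ∸ q <_) (m+n∸n≡m q q) (∸-monoˡ-< a<2q q≤a)

    ∤-C : ∀ {n k e f} → k ≤ n → Valuation q (n !) (e + f) →
          Valuation q (k !) e → Valuation q ((n ∸ k) !) f → ¬ q ∣ n C k
    ∤-C {n} {k} {e} {f} k≤n (valuation u q∤u n!≡) (valuation v _ k!≡) (valuation w _ [n∸k]!≡) q∣C =
      q∤u (subst (q ∣_) C*v*w≡u (∣m⇒∣m*n (v * w) q∣C))
      where
      instance _ = m^n≢0 q (e + f)
      C*v*w≡u : (n C k) * (v * w) ≡ u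
      C*v*w≡u = *-cancelˡ-≡ _ _ (q ^ (e + f)) (begin
        q ^ (e + f) * ((n C k) * (v * w))       ≡⟨ cong (_* ((n C k) * (v * w))) (^-distribˡ-+-* q e f) ⟩
        q ^ e * q ^ f * ((n C k) * (v * w))     ≡⟨ solve 5 (λ x y c v w → x :* y :* (c :* (v :* w)) := c :* (x :* v :* (y :* w)))
                                                       refl (q ^ e) (q ^ f) (n C k) v w ⟩
        (n C k) * (q ^ e * v * (q ^ f * w))     ≡⟨ cong₂ (λ x y → (n C k) * (x * y)) k!≡ [n∸k]!≡ ⟨
        (n C k) * (k ! * (n ∸ k) !)             ≡⟨ nCk*k!*[n∸k]!≡n! k≤n ⟩
        n !                                     ≡⟨ n!≡ ⟩
        q ^ (e + f) * u                         ∎)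
        where open ≡-Reasoning

    Valuation-![[cq+c]∸[kq+s]] : ∀ {c k s} → k ≤ c → s ≤ c → c ∸ k < q → c ∸ s < q →
                                  Valuation q (((c * q + c) ∸ (k * q + s)) !) (c ∸ k)
    Valuation-![[cq+c]∸[kq+s]] {c} {k} k≤c s≤c c∸k<q c∸s<q =
      subst (λ n → Valuation q (n !) (c ∸ k)) (sym ([cq+c]∸[kq+s]≡[c∸k]q+[c∸s] q k≤c s≤c))
        (Valuation-!-digits c∸k<q c∸s<q)

    ∤-[cq+c]C[kq+s]-c<q : ∀ {c k s} → c < q → k ≤ c → s ≤ c → ¬ q ∣ (c * q + c) C (k * q + s)
    ∤-[cq+c]C[kq+s]-c<q {c} {k} {s} c<q k≤c s≤c = ∤-C (+-mono-≤ (*-monoˡ-≤ q k≤c) s≤c)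
      (subst (Valuation q _) (sym (m+[n∸m]≡n k≤c)) (Valuation-!-digits c<q c<q))
      (Valuation-!-digits (≤-<-trans k≤c c<q) (≤-<-trans s≤c c<q))
      (Valuation-![[cq+c]∸[kq+s]] k≤c s≤c (≤-<-trans (m∸n≤m c k) c<q) (≤-<-trans (m∸n≤m c s) c<q))

    -- c q + c = (c + 1) q + (c ∸ q) and k q + s = (k + 1) q + (s ∸ q) both carry once in base q.
    ∤-[cq+c]C[kq+s]-q≤k : ∀ {c k s} → q ≤ k → k ≤ s → s ≤ c → suc c < q + q →
                           ¬ q ∣ (c * q + c) C (k * q + s)
    ∤-[cq+c]C[kq+s]-q≤k {c} {k} {s} q≤k k≤s s≤c 1+c<2q = ∤-C (+-mono-≤ (*-monoˡ-≤ q k≤c) s≤c)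
      (subst₂ (λ n → Valuation q (n !)) (sym (a*q+b≡[1+a]*q+[b∸q] c q≤c)) exponents
        (Valuation-! (suc c) 1 c∸q<q (Valuation-!-<2q (≤-trans q≤c (n≤1+n c)) 1+c<2q)))
      (subst (λ n → Valuation q (n !) (suc k + 1)) (sym (a*q+b≡[1+a]*q+[b∸q] k (≤-trans q≤k k≤s)))
        (Valuation-! (suc k) 1 (≤-<-trans (∸-monoˡ-≤ q s≤c) c∸q<q)
          (Valuation-!-<2q (≤-trans q≤k (n≤1+n k)) (≤-<-trans (s≤s k≤c) 1+c<2q))))
      (Valuation-![[cq+c]∸[kq+s]] k≤c s≤c (≤-<-trans (∸-monoʳ-≤ c q≤k) c∸q<q)
        (≤-<-trans (∸-monoʳ-≤ c (≤-trans q≤k k≤s)) c∸q<q))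
      where
      k≤c = ≤-trans k≤s s≤c
      q≤c = ≤-trans q≤k k≤c
      c∸q<q : c ∸ q < q
      c∸q<q = subst (c ∸ q <_) (m+n∸n≡m q q) (∸-monoˡ-< (<⇒≤ 1+c<2q) q≤c)
      exponents : suc c + 1 ≡ suc k + 1 + (c ∸ k)
      exponents = begin
        suc c + 1                 ≡⟨ cong (λ x → suc x + 1) (m+[n∸m]≡n k≤c) ⟨
        suc (k + (c ∸ k)) + 1     ≡⟨ solve 2 (λ k d → con 1 :+ (k :+ d) :+ con 1 := con 1 :+ k :+ con 1 :+ d) refl k (c ∸ k) ⟩
        suc k + 1 + (c ∸ k)       ∎
        where open ≡-Reasoning

  BinomDiv⇒∣[cq+c]C[kq+s] : ∀ {p r c k q} → p ∣ suc q → p * k + r * suc q ≤ p * c → BinomDiv p r c k →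
                            ∃[ s ] (k ≤ s × s ≤ c × q ∣ (c * q + c) C (k * q + s))
  BinomDiv⇒∣[cq+c]C[kq+s] {p} {r} {c} {k} {q} (divides n 1+q≡np) bound div =
    k + r * n , m≤m+n k (r * n) , s≤c , subst₂ _∣_ pn∸1≡q (cong₂ _C_ pcn≡cq+c [pk+r]n≡kq+s) (div n 1≤n)
    where
    pn≡1+q : p * n ≡ suc q
    pn≡1+q = trans (*-comm p n) (sym 1+q≡np)
    1≤n : n ≥ 1
    1≤n = n≢0⇒n>0 (λ { refl → 0≢1+n (trans (sym (*-zeroʳ p)) pn≡1+q) })
    instance
      p≢0 : NonZero p
      p≢0 = ≢-nonZero (λ { refl → 0≢1+n pn≡1+q })
    pn∸1≡q : p * n ∸ 1 ≡ q
    pn∸1≡q = cong (_∸ 1) pn≡1+q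
    pcn≡cq+c : p * c * n ≡ c * q + c
    pcn≡cq+c = begin
      p * c * n     ≡⟨ solve 3 (λ p c n → p :* c :* n := c :* (p :* n)) refl p c n ⟩
      c * (p * n)   ≡⟨ cong (c *_) pn≡1+q ⟩
      c * suc q     ≡⟨ solve 2 (λ c q → c :* (con 1 :+ q) := c :* q :+ c) refl c q ⟩
      c * q + c     ∎
      where open ≡-Reasoning
    [pk+r]n≡kq+s : (p * k + r) * n ≡ k * q + (k + r * n)
    [pk+r]n≡kq+s = begin
      (p * k + r) * n        ≡⟨ solve 4 (λ p k r n → (p :* k :+ r) :* n := k :* (p :* n) :+ r :* n) refl p k r n ⟩
      k * (p * n) + r * n    ≡⟨ cong (λ x → k * x + r * n) pn≡1+q ⟩
      k * suc q + r * n      ≡⟨ solve 3 (λ k q x → k :* (con 1 :+ q) :+ x := k :* q :+ (k :+ x)) refl k q (r * n) ⟩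
      k * q + (k + r * n)    ∎
      where open ≡-Reasoning
    s≤c : k + r * n ≤ c
    s≤c = *-cancelˡ-≤ p (begin
      p * (k + r * n)        ≡⟨ solve 4 (λ p k r n → p :* (k :+ r :* n) := p :* k :+ r :* (p :* n)) refl p k r n ⟩
      p * k + r * (p * n)    ≡⟨ cong (λ x → p * k + r * x) pn≡1+q ⟩
      p * k + r * suc q      ≤⟨ bound ⟩
      p * c                  ∎)
      where open ≤-Reasoning

module RationalArithmetic where

  open import Data.Integer.Base as ℤ using (ℤ; +_)
  import Data.Integer.Properties as ℤ
  import Data.Integer.Tactic.RingSolver as ℤ-Solver
  open import Data.List.Base using (_∷_; [])
  open import Data.Nat.Base as ℕ using (ℕ; suc)
  import Data.Nat.Properties as ℕ
  open import Data.Rational.Base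
  open import Data.Rational.Properties
  open import Data.Rational.Unnormalised.Base as ℚᵘ using (mkℚᵘ; *≡*; *≤*; *<*)
  import Data.Rational.Unnormalised.Properties as ℚᵘ
  open import Level using (0ℓ)
  open import Relation.Binary.PropositionalEquality
  open import Relation.Nullary.Decidable using (dec⇒maybe)
  open import Tactic.RingSolver using (solve)
  import Tactic.RingSolver.Core.AlmostCommutativeRing as ACR

  ℚ-ring : ACR.AlmostCommutativeRing 0ℓ 0ℓ
  ℚ-ring = ACR.fromCommutativeRing +-*-commutativeRing (λ x → dec⇒maybe (0ℚ ≟ x))

  fromℤ : ℤ → ℚ
  fromℤ z = z / 1

  toℚᵘ-fromℤ : ∀ z → toℚᵘ (fromℤ z) ℚᵘ.≃ mkℚᵘ z 0
  toℚᵘ-fromℤ z = toℚᵘ-fromℚᵘ (mkℚᵘ z 0)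

  fromℤ-+ : ∀ a b → fromℤ (a ℤ.+ b) ≡ fromℤ a + fromℤ b
  fromℤ-+ a b = toℚᵘ-injective (begin-equality
    toℚᵘ (fromℤ (a ℤ.+ b))            ≃⟨ toℚᵘ-fromℤ (a ℤ.+ b) ⟩
    mkℚᵘ (a ℤ.+ b) 0                  ≃⟨ *≡* numerators ⟩
    mkℚᵘ a 0 ℚᵘ.+ mkℚᵘ b 0            ≃⟨ ℚᵘ.+-cong (toℚᵘ-fromℤ a) (toℚᵘ-fromℤ b) ⟨
    toℚᵘ (fromℤ a) ℚᵘ.+ toℚᵘ (fromℤ b) ≃⟨ toℚᵘ-homo-+ (fromℤ a) (fromℤ b) ⟨
    toℚᵘ (fromℤ a + fromℤ b)          ∎)
    where
    open ℚᵘ.≤-Reasoning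
    numerators : (a ℤ.+ b) ℤ.* ℤ.1ℤ ≡ (a ℤ.* ℤ.1ℤ ℤ.+ b ℤ.* ℤ.1ℤ) ℤ.* ℤ.1ℤ
    numerators = ℤ-Solver.solve (a ∷ b ∷ [])

  fromℤ-* : ∀ a b → fromℤ (a ℤ.* b) ≡ fromℤ a * fromℤ b
  fromℤ-* a b = toℚᵘ-injective (begin-equality
    toℚᵘ (fromℤ (a ℤ.* b))            ≃⟨ toℚᵘ-fromℤ (a ℤ.* b) ⟩
    mkℚᵘ a 0 ℚᵘ.* mkℚᵘ b 0            ≃⟨ ℚᵘ.*-cong (toℚᵘ-fromℤ a) (toℚᵘ-fromℤ b) ⟨
    toℚᵘ (fromℤ a) ℚᵘ.* toℚᵘ (fromℤ b) ≃⟨ toℚᵘ-homo-* (fromℤ a) (fromℤ b) ⟨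
    toℚᵘ (fromℤ a * fromℤ b)          ∎)
    where open ℚᵘ.≤-Reasoning

  fromℤ-neg : ∀ a → fromℤ (ℤ.- a) ≡ - fromℤ a
  fromℤ-neg a = toℚᵘ-injective (begin-equality
    toℚᵘ (fromℤ (ℤ.- a))   ≃⟨ toℚᵘ-fromℤ (ℤ.- a) ⟩
    ℚᵘ.- mkℚᵘ a 0          ≃⟨ ℚᵘ.-‿cong (toℚᵘ-fromℤ a) ⟨
    ℚᵘ.- toℚᵘ (fromℤ a)    ≃⟨ toℚᵘ-homo‿- (fromℤ a) ⟨
    toℚᵘ (- fromℤ a)       ∎)
    where open ℚᵘ.≤-Reasoning

  ι[d]*[z/d]≡z : ∀ z d → ι (suc d) * (z / suc d) ≡ fromℤ z
  ι[d]*[z/d]≡z z d = toℚᵘ-injective (begin-equality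
    toℚᵘ (ι (suc d) * (z / suc d))            ≃⟨ toℚᵘ-homo-* (ι (suc d)) (z / suc d) ⟩
    toℚᵘ (ι (suc d)) ℚᵘ.* toℚᵘ (z / suc d)     ≃⟨ ℚᵘ.*-cong (toℚᵘ-fromℤ (+ suc d)) (toℚᵘ-fromℚᵘ (mkℚᵘ z d)) ⟩
    mkℚᵘ (+ suc d) 0 ℚᵘ.* mkℚᵘ z d            ≃⟨ *≡* cross ⟩
    mkℚᵘ z 0                                  ≃⟨ toℚᵘ-fromℤ z ⟨
    toℚᵘ (fromℤ z)                            ∎)
    where
    open ℚᵘ.≤-Reasoning
    cross : (+ suc d ℤ.* z) ℤ.* ℤ.1ℤ ≡ z ℤ.* + suc (d ℕ.+ 0)
    cross rewrite ℕ.+-identityʳ d = trans (ℤ.*-identityʳ _) (ℤ.*-comm (+ suc d) z)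

  ι-+ : ∀ m n → ι (m ℕ.+ n) ≡ ι m + ι n
  ι-+ m n = fromℤ-+ (+ m) (+ n)

  ι-* : ∀ m n → ι (m ℕ.* n) ≡ ι m * ι n
  ι-* m n = trans (cong fromℤ (ℤ.pos-* m n)) (fromℤ-* (+ m) (+ n))

  ι-suc : ∀ n → ι (suc n) ≡ 1ℚ + ι n
  ι-suc = ι-+ 1

  fromℤ[m-n]≡ιm-ιn : ∀ m n → fromℤ (+ m ℤ.- + n) ≡ ι m - ι n
  fromℤ[m-n]≡ιm-ιn m n = trans (fromℤ-+ (+ m) (ℤ.- + n)) (cong (λ x → ι m + x) (fromℤ-neg (+ n)))

  ι-∸ : ∀ {m n} → n ℕ.≤ m → ι (m ℕ.∸ n) ≡ ι m - ι n
  ι-∸ {m} {n} n≤m = begin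
    ι (m ℕ.∸ n)                   ≡⟨ x≡[y+x]-y (ι (m ℕ.∸ n)) (ι n) ⟩
    ι n + ι (m ℕ.∸ n) - ι n       ≡⟨ cong (_- ι n) (ι-+ n (m ℕ.∸ n)) ⟨
    ι (n ℕ.+ (m ℕ.∸ n)) - ι n     ≡⟨ cong (λ x → ι x - ι n) (ℕ.m+[n∸m]≡n n≤m) ⟩
    ι m - ι n                     ∎
    where
    open ≡-Reasoning
    x≡[y+x]-y : ∀ x y → x ≡ y + x - y
    x≡[y+x]-y x y = solve (x ∷ y ∷ []) ℚ-ring

  ι-mono-≤ : ∀ {m n} → m ℕ.≤ n → ι m ≤ ι n
  ι-mono-≤ {m} {n} m≤n = toℚᵘ-cancel-≤ (begin
    toℚᵘ (ι m)    ≃⟨ toℚᵘ-fromℤ (+ m) ⟩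
    mkℚᵘ (+ m) 0  ≤⟨ *≤* (ℤ.*-monoʳ-≤-nonNeg (+ 1) (ℤ.+≤+ m≤n)) ⟩
    mkℚᵘ (+ n) 0  ≃⟨ toℚᵘ-fromℤ (+ n) ⟨
    toℚᵘ (ι n)    ∎)
    where open ℚᵘ.≤-Reasoning

  ι-mono-< : ∀ {m n} → m ℕ.< n → ι m < ι n
  ι-mono-< {m} {n} m<n = toℚᵘ-cancel-< (begin-strict
    toℚᵘ (ι m)    ≃⟨ toℚᵘ-fromℤ (+ m) ⟩
    mkℚᵘ (+ m) 0  <⟨ *<* (ℤ.*-monoʳ-<-pos (+ 1) (ℤ.+<+ m<n)) ⟩
    mkℚᵘ (+ n) 0  ≃⟨ toℚᵘ-fromℤ (+ n) ⟨
    toℚᵘ (ι n)    ∎)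
    where open ℚᵘ.≤-Reasoning

  ι-cancel-< : ∀ {m n} → ι m < ι n → m ℕ.< n
  ι-cancel-< {m} {n} ιm<ιn with ℚᵘ.<-respˡ-≃ (toℚᵘ-fromℤ (+ m)) (ℚᵘ.<-respʳ-≃ (toℚᵘ-fromℤ (+ n)) (toℚᵘ-mono-< ιm<ιn))
  ... | *<* m*1<n*1 = ℤ.drop‿+<+ (ℤ.*-cancelʳ-<-nonNeg (+ 1) m*1<n*1)

  ι-nonNeg : ∀ n → 0ℚ ≤ ι n
  ι-nonNeg n = ι-mono-≤ {0} {n} ℕ.z≤n

  ι-pos : ∀ n .{{_ : ℕ.NonZero n}} → Positive (ι n)
  ι-pos (suc n) = positive (ι-mono-< {0} {suc n} (ℕ.s≤s ℕ.z≤n))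

  γ-spec : ∀ p r .{{_ : ℕ.NonZero p}} →
           ι p * ι p * (1ℚ + ι p) * γ p r ≡ ι p * ι p * ι r + ι p * ι p + ι r * ι r - ι p * ι r
  γ-spec p@(suc _) r = begin
    ι p * ι p * (1ℚ + ι p) * γ p r                       ≡⟨ cong (_* γ p r) denominator ⟨
    ι (p ℕ.* p ℕ.* suc p) * γ p r                        ≡⟨ ι[d]*[z/d]≡z (+ (p ℕ.* p ℕ.* r ℕ.+ p ℕ.* p ℕ.+ r ℕ.* r) ℤ.- + (p ℕ.* r))
                                                                           (ℕ.pred (p ℕ.* p ℕ.* suc p)) ⟩
    fromℤ (+ (p ℕ.* p ℕ.* r ℕ.+ p ℕ.* p ℕ.+ r ℕ.* r) ℤ.- + (p ℕ.* r))
                                                         ≡⟨ fromℤ[m-n]≡ιm-ιn (p ℕ.* p ℕ.* r ℕ.+ p ℕ.* p ℕ.+ r ℕ.* r) (p ℕ.* r) ⟩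
    ι (p ℕ.* p ℕ.* r ℕ.+ p ℕ.* p ℕ.+ r ℕ.* r) - ι (p ℕ.* r)
                                                         ≡⟨ cong₂ _-_ numerator (ι-* p r) ⟩
    ι p * ι p * ι r + ι p * ι p + ι r * ι r - ι p * ι r  ∎
    where
    open ≡-Reasoning
    denominator : ι (p ℕ.* p ℕ.* suc p) ≡ ι p * ι p * (1ℚ + ι p)
    denominator = trans (ι-* (p ℕ.* p) (suc p)) (cong₂ _*_ (ι-* p p) (ι-suc p))
    numerator : ι (p ℕ.* p ℕ.* r ℕ.+ p ℕ.* p ℕ.+ r ℕ.* r) ≡ ι p * ι p * ι r + ι p * ι p + ι r * ι r
    numerator = begin
      ι (p ℕ.* p ℕ.* r ℕ.+ p ℕ.* p ℕ.+ r ℕ.* r)          ≡⟨ ι-+ (p ℕ.* p ℕ.* r ℕ.+ p ℕ.* p) (r ℕ.* r) ⟩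
      ι (p ℕ.* p ℕ.* r ℕ.+ p ℕ.* p) + ι (r ℕ.* r)        ≡⟨ cong₂ _+_ (ι-+ (p ℕ.* p ℕ.* r) (p ℕ.* p)) (ι-* r r) ⟩
      ι (p ℕ.* p ℕ.* r) + ι (p ℕ.* p) + ι r * ι r        ≡⟨ cong₂ (λ x y → x + y + ι r * ι r)
                                                              (trans (ι-* (p ℕ.* p) r) (cong (_* ι r) (ι-* p p))) (ι-* p p) ⟩
      ι p * ι p * ι r + ι p * ι p + ι r * ι r            ∎

  ε₁-spec : ∀ p r .{{_ : ℕ.NonZero p}} .{{_ : ℕ.NonZero r}} →
            ι p * ι r * (1ℚ + ι p) * ε₁ p r ≡ (ι p - ι r) * (ι p - ι r)
  ε₁-spec p@(suc _) r@(suc _) = begin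
    ι p * ι r * (1ℚ + ι p) * ε₁ p r             ≡⟨ cong (_* ε₁ p r) denominator ⟨
    ι (p ℕ.* r ℕ.* suc p) * ε₁ p r              ≡⟨ ι[d]*[z/d]≡z ((+ p ℤ.- + r) ℤ.* (+ p ℤ.- + r))
                                                                  (ℕ.pred (p ℕ.* r ℕ.* suc p)) ⟩
    fromℤ ((+ p ℤ.- + r) ℤ.* (+ p ℤ.- + r))     ≡⟨ fromℤ-* (+ p ℤ.- + r) (+ p ℤ.- + r) ⟩
    fromℤ (+ p ℤ.- + r) * fromℤ (+ p ℤ.- + r)   ≡⟨ cong₂ _*_ (fromℤ[m-n]≡ιm-ιn p r) (fromℤ[m-n]≡ιm-ιn p r) ⟩
    (ι p - ι r) * (ι p - ι r)                   ∎
    where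
    open ≡-Reasoning
    denominator : ι (p ℕ.* r ℕ.* suc p) ≡ ι p * ι r * (1ℚ + ι p)
    denominator = trans (ι-* (p ℕ.* r) (suc p)) (cong₂ _*_ (ι-* p r) (ι-suc p))

  ε₂-spec : ∀ p r → (1ℚ + ι p) * ε₂ p r ≡ ι p - ((1ℚ + 1ℚ) * ι r + 1ℚ)
  ε₂-spec p r = begin
    (1ℚ + ι p) * ε₂ p r                 ≡⟨ cong (_* ε₂ p r) (ι-suc p) ⟨
    ι (suc p) * ε₂ p r                  ≡⟨ ι[d]*[z/d]≡z (+ p ℤ.- + (2 ℕ.* r ℕ.+ 1)) p ⟩
    fromℤ (+ p ℤ.- + (2 ℕ.* r ℕ.+ 1))   ≡⟨ fromℤ[m-n]≡ιm-ιn p (2 ℕ.* r ℕ.+ 1) ⟩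
    ι p - ι (2 ℕ.* r ℕ.+ 1)             ≡⟨ cong (λ x → ι p - x) (trans (ι-+ (2 ℕ.* r) 1) (cong (_+ 1ℚ) (ι-* 2 r))) ⟩
    ι p - ((1ℚ + 1ℚ) * ι r + 1ℚ)        ∎
    where open ≡-Reasoning

  *-cancelˡ-≡-pos : ∀ r .{{_ : Positive r}} {p q} → r * p ≡ r * q → p ≡ q
  *-cancelˡ-≡-pos r rp≡rq =
    ≤-antisym (*-cancelˡ-≤-pos r (≤-reflexive rp≡rq)) (*-cancelˡ-≤-pos r (≤-reflexive (sym rp≡rq)))

  module _ {P R g : ℚ} .{{_ : Positive P}}
           (γ-eq : P * P * (1ℚ + P) * g ≡ P * P * R + P * P + R * R - P * R) where

    private instance
      D-pos : Positive (P * P * (1ℚ + P))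
      D-pos = pos*pos⇒pos (P * P) {{pos*pos⇒pos P P}} (1ℚ + P) {{pos+pos⇒pos 1ℚ P}}

    R[1+ε₁]≡Pγ : ∀ {e} → P * R * (1ℚ + P) * e ≡ (P - R) * (P - R) → R * (1ℚ + e) ≡ P * g
    R[1+ε₁]≡Pγ {e} ε₁-eq = *-cancelˡ-≡-pos (P * P * (1ℚ + P)) (begin
      P * P * (1ℚ + P) * (R * (1ℚ + e))              ≡⟨ solve (P ∷ R ∷ e ∷ []) ℚ-ring ⟩
      R * (P * P * (1ℚ + P)) + P * (P * R * (1ℚ + P) * e) ≡⟨ cong (λ x → R * (P * P * (1ℚ + P)) + P * x) ε₁-eq ⟩
      R * (P * P * (1ℚ + P)) + P * ((P - R) * (P - R))  ≡⟨ solve (P ∷ R ∷ []) ℚ-ring ⟩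
      P * (P * P * R + P * P + R * R - P * R)          ≡⟨ cong (λ x → P * x) γ-eq ⟨
      P * (P * P * (1ℚ + P) * g)                       ≡⟨ solve (P ∷ g ∷ []) ℚ-ring ⟩
      P * P * (1ℚ + P) * (P * g)                       ∎)
      where open ≡-Reasoning

    ½[1+ε₂]≤1-γ : ∀ {e} → 0ℚ ≤ R * (P - R) → (1ℚ + P) * e ≡ P - ((1ℚ + 1ℚ) * R + 1ℚ) → ½ * (1ℚ + e) ≤ 1ℚ - g
    ½[1+ε₂]≤1-γ {e} 0≤R[P-R] ε₂-eq = *-cancelˡ-≤-pos (P * P * (1ℚ + P)) (begin
      P * P * (1ℚ + P) * (½ * (1ℚ + e))                              ≡⟨ +-identityʳ _ ⟨
      P * P * (1ℚ + P) * (½ * (1ℚ + e)) + 0ℚ                         ≤⟨ +-monoʳ-≤ (P * P * (1ℚ + P) * (½ * (1ℚ + e))) 0≤R[P-R] ⟩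
      P * P * (1ℚ + P) * (½ * (1ℚ + e)) + R * (P - R)                ≡⟨ solve (P ∷ R ∷ e ∷ []) ℚ-ring ⟩
      ½ * (P * P * (1ℚ + P) + P * P * ((1ℚ + P) * e)) + R * (P - R)  ≡⟨ cong (λ x → ½ * (P * P * (1ℚ + P) + P * P * x) + R * (P - R)) ε₂-eq ⟩
      ½ * (P * P * (1ℚ + P) + P * P * (P - ((1ℚ + 1ℚ) * R + 1ℚ))) + R * (P - R) ≡⟨ solve (P ∷ R ∷ []) ℚ-ring ⟩
      P * P * (1ℚ + P) - (P * P * R + P * P + R * R - P * R)         ≡⟨ cong (λ x → P * P * (1ℚ + P) - x) γ-eq ⟨
      P * P * (1ℚ + P) - P * P * (1ℚ + P) * g                        ≡⟨ solve (P ∷ g ∷ []) ℚ-ring ⟩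
      P * P * (1ℚ + P) * (1ℚ - g)                                    ∎)
      where open ≤-Reasoning

  R*X+Y<C*P : ∀ {P R C X Y e g} .{{_ : Positive R}} → R * (1ℚ + e) ≡ P * g →
              X < (1ℚ + e) * C → Y ≤ C * P * (1ℚ - g) → R * X + Y < C * P
  R*X+Y<C*P {P} {R} {C} {X} {Y} {e} {g} R[1+e]≡Pg X<[1+e]C Y≤CP[1-g] = begin-strict
    R * X + Y                                  <⟨ +-mono-<-≤ (*-monoʳ-<-pos R X<[1+e]C) Y≤CP[1-g] ⟩
    R * ((1ℚ + e) * C) + C * P * (1ℚ - g)      ≡⟨ solve (P ∷ R ∷ C ∷ e ∷ g ∷ []) ℚ-ring ⟩
    C * (R * (1ℚ + e)) + C * P - C * (P * g)   ≡⟨ cong (λ x → C * x + C * P - C * (P * g)) R[1+e]≡Pg ⟩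
    C * (P * g) + C * P - C * (P * g)          ≡⟨ solve (P ∷ C ∷ g ∷ []) ℚ-ring ⟩
    C * P                                      ∎
    where open ≤-Reasoning

  P*X<Y : ∀ {P C X Y e g} .{{_ : Positive P}} .{{_ : NonNegative C}} → ½ * (1ℚ + e) ≤ 1ℚ - g →
          X < (1ℚ + e) * (½ * C) → C * P * (1ℚ - g) < Y → P * X < Y
  P*X<Y {P} {C} {X} {Y} {e} {g} ½[1+e]≤1-g X<[1+e]½C CP[1-g]<Y = begin-strict
    P * X                     <⟨ *-monoʳ-<-pos P X<[1+e]½C ⟩
    P * ((1ℚ + e) * (½ * C))  ≡⟨ solve (P ∷ C ∷ e ∷ []) ℚ-ring ⟩
    C * P * (½ * (1ℚ + e))    ≤⟨ *-monoˡ-≤-nonNeg (C * P) {{nonNeg*nonNeg⇒nonNeg C P {{pos⇒nonNeg P}}}} ½[1+e]≤1-g ⟩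
    C * P * (1ℚ - g)          <⟨ CP[1-g]<Y ⟩
    Y                         ∎
    where open ≤-Reasoning

  x+x≤y⇒x≤½y : ∀ {x y} → x + x ≤ y → x ≤ ½ * y
  x+x≤y⇒x≤½y {x} {y} x+x≤y = begin
    x              ≡⟨ solve (x ∷ []) ℚ-ring ⟩
    ½ * (x + x)    ≤⟨ *-monoˡ-≤-nonNeg ½ x+x≤y ⟩
    ½ * y          ∎
    where open ≤-Reasoning

  ½x<y⇒x<y+y : ∀ {x y} → ½ * x < y → x < y + y
  ½x<y⇒x<y+y {x} {y} ½x<y = begin-strict
    x                ≡⟨ solve (x ∷ []) ℚ-ring ⟩
    ½ * x + ½ * x    <⟨ +-mono-< ½x<y ½x<y ⟩
    y + y            ∎
    where open ≤-Reasoning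

open import Data.Empty using (⊥-elim)
open import Data.Nat.Base
open import Data.Nat.Properties
open import Data.Nat.Primality using (Prime; prime⇒nonZero)
open import Data.Nat.Solver using (module +-*-Solver)
open +-*-Solver using (solve; con; _:+_; _:*_; _:=_)
open import Data.Product using (∃-syntax; _×_; _,_)
open import Relation.Binary.PropositionalEquality
open import Relation.Binary.Definitions using (tri<; tri≈; tri>)
open import Relation.Nullary using (¬_)
import Data.Rational as Q
import Data.Rational.Properties as Q

open BinomialValuations
open RationalArithmetic using (ι-+; ι-*; ι-∸; ι-mono-≤; ι-cancel-<; ι-nonNeg; ι-pos; γ-spec; ε₁-spec; ε₂-spec;
                               R[1+ε₁]≡Pγ; ½[1+ε₂]≤1-γ; R*X+Y<C*P; P*X<Y; x+x≤y⇒x≤½y; ½x<y⇒x<y+y)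

distinct⇒suc-c<t+t : ∀ {P : ℕ → Set} {c q q'} → q ≢ q' → P q → P q' → c < q + q → c < q' + q' →
                     ∃[ t ] (P t × suc c < t + t)
distinct⇒suc-c<t+t {q = q} {q'} q≢q' Pq Pq' c<2q c<2q' with <-cmp q q'
... | tri< q<q' _ _ = q' , Pq' , ≤-<-trans c<2q (+-mono-< q<q' q<q')
... | tri≈ _ q≡q' _ = ⊥-elim (q≢q' q≡q')
... | tri> _ _ q'<q = q , Pq , ≤-<-trans c<2q' (+-mono-< q'<q q'<q)

pk+r[1+q]≤pc : ∀ {p r c k q} .{{_ : NonZero p}} .{{_ : NonZero r}} →
               ι q Q.< (Q.1ℚ Q.+ ε₁ p r) Q.* ι c → ι (p * k + r) Q.≤ ι (c * p) Q.* (Q.1ℚ Q.- γ p r) →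
               p * k + r * suc q ≤ p * c
pk+r[1+q]≤pc {p} {r} {c} {k} {q} q<[1+ε]c pk+r≤cp[1-γ] = begin
  p * k + r * suc q      ≡⟨ solve 4 (λ p k r q → p :* k :+ r :* (con 1 :+ q) := r :* q :+ (p :* k :+ r)) refl p k r q ⟩
  r * q + (p * k + r)    <⟨ ι-cancel-< (subst₂ Q._<_ (sym (trans (ι-+ (r * q) _) (cong (Q._+ ι (p * k + r)) (ι-* r q)))) (sym (ι-* c p))
                             (R*X+Y<C*P {ι p} {ι r} {ι c} {ι q} {ι (p * k + r)} {ε₁ p r} {γ p r} {{ι-pos r}}
                               (R[1+ε₁]≡Pγ {ι p} {ι r} {γ p r} {{ι-pos p}} (γ-spec p r) {ε₁ p r} (ε₁-spec p r)) q<[1+ε]c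
                               (subst (λ x → ι (p * k + r) Q.≤ x Q.* (Q.1ℚ Q.- γ p r)) (ι-* c p) pk+r≤cp[1-γ]))) ⟩
  c * p                  ≡⟨ *-comm c p ⟩
  p * c                  ∎
  where open ≤-Reasoning

pt<pk+r : ∀ {p r c k t} .{{_ : NonZero p}} → r ≤ p →
          ι t Q.< (Q.1ℚ Q.+ ε₂ p r) Q.* (Q.½ Q.* ι c) → ι (c * p) Q.* (Q.1ℚ Q.- γ p r) Q.< ι (p * k + r) →
          p * t < p * k + r
pt<pk+r {p} {r} {c} {k} {t} r≤p t<[1+ε]½c cp[1-γ]<pk+r = ι-cancel-< (subst (Q._< ι (p * k + r)) (sym (ι-* p t))
  (P*X<Y {ι p} {ι c} {ι t} {ι (p * k + r)} {ε₂ p r} {γ p r} {{ι-pos p}} {{Q.nonNegative (ι-nonNeg c)}}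
    (½[1+ε₂]≤1-γ {ι p} {ι r} {γ p r} {{ι-pos p}} (γ-spec p r) {ε₂ p r} 0≤r[p-r] (ε₂-spec p r)) t<[1+ε]½c
    (subst (λ x → x Q.* (Q.1ℚ Q.- γ p r) Q.< ι (p * k + r)) (ι-* c p) cp[1-γ]<pk+r)))
  where
  0≤r[p-r] : Q.0ℚ Q.≤ ι r Q.* (ι p Q.- ι r)
  0≤r[p-r] = subst (Q.0ℚ Q.≤_) (trans (ι-* r (p ∸ r)) (cong (ι r Q.*_) (ι-∸ r≤p))) (ι-nonNeg (r * (p ∸ r)))

pt<pk+r⇒t≤k : ∀ {p r k t} → r ≤ p → p * t < p * k + r → t ≤ k
pt<pk+r⇒t≤k {p} {r} {k} {t} r≤p pt<pk+r = s≤s⁻¹ (*-cancelˡ-< p t (suc k) (begin-strict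
  p * t        <⟨ pt<pk+r ⟩
  p * k + r    ≤⟨ +-monoʳ-≤ (p * k) r≤p ⟩
  p * k + p    ≡⟨ solve 2 (λ p k → p :* k :+ p := p :* (con 1 :+ k)) refl p k ⟩
  p * suc k    ∎))
  where open ≤-Reasoning

pk+r<c[p∸r]⇒k<c : ∀ {p r c k} → p * k + r < c * (p ∸ r) → k < c
pk+r<c[p∸r]⇒k<c {p} {r} {c} {k} pk+r<c[p∸r] = *-cancelˡ-< p k c (begin-strict
  p * k          ≤⟨ m≤m+n (p * k) r ⟩
  p * k + r      <⟨ pk+r<c[p∸r] ⟩
  c * (p ∸ r)    ≤⟨ *-monoʳ-≤ c (m∸n≤m p r) ⟩
  c * p          ≡⟨ *-comm c p ⟩
  p * c          ∎)
  where open ≤-Reasoning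

pk+r[1+t]≤pc : ∀ {p r c k t} → r ≤ p → t ≤ c → p * k + r < c * (p ∸ r) → p * k + r * suc t ≤ p * c
pk+r[1+t]≤pc {p} {r} {c} {k} {t} r≤p t≤c pk+r<c[p∸r] = begin
  p * k + r * suc t        ≡⟨ solve 4 (λ p k r t → p :* k :+ r :* (con 1 :+ t) := p :* k :+ r :+ r :* t) refl p k r t ⟩
  p * k + r + r * t        ≤⟨ +-monoʳ-≤ (p * k + r) (*-monoʳ-≤ r t≤c) ⟩
  p * k + r + r * c        ≤⟨ +-monoˡ-≤ (r * c) (<⇒≤ pk+r<c[p∸r]) ⟩
  c * (p ∸ r) + r * c      ≡⟨ cong₂ _+_ (*-distribˡ-∸ c p r) (*-comm r c) ⟩
  (c * p ∸ c * r) + c * r  ≡⟨ m∸n+n≡m (*-monoʳ-≤ c r≤p) ⟩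
  c * p                    ≡⟨ *-comm c p ⟩
  p * c                    ∎
  where open ≤-Reasoning

¬BinomDiv-below : ∀ {p r M} .{{_ : NonZero p}} .{{_ : NonZero r}} → IsMp p (ε₁ p r) M →
                  ∀ {c k} → M Q.≤ ι c → ι (p * k + r) Q.≤ ι (c * p) Q.* (Q.1ℚ Q.- γ p r) → ¬ BinomDiv p r c k
¬BinomDiv-below isMp {c} M≤c pk+r≤cp[1-γ] div =
  let q , q-prime , p∣1+q , c<q , q<[1+ε]c = isMp (ι c) M≤c
      s , k≤s , s≤c , q∣C = BinomDiv⇒∣[cq+c]C[kq+s] p∣1+q (pk+r[1+q]≤pc q<[1+ε]c pk+r≤cp[1-γ]) div
  in ∤-[cq+c]C[kq+s]-c<q q-prime (ι-cancel-< c<q) (≤-trans k≤s s≤c) s≤c q∣C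

¬BinomDiv-above : ∀ {p r M'} .{{_ : NonZero p}} → r ≤ p → IsM'p p (ε₂ p r) M' →
                  ∀ {c k} → M' Q.+ M' Q.≤ ι k → ι (c * p) Q.* (Q.1ℚ Q.- γ p r) Q.< ι (p * k + r) →
                  p * k + r < c * (p ∸ r) → ¬ BinomDiv p r c k
¬BinomDiv-above {p} {r} r≤p isM'p {c} {k} 2M'≤k cp[1-γ]<pk+r pk+r<c[p∸r] div =
  let k<c = pk+r<c[p∸r]⇒k<c {p} {r} pk+r<c[p∸r]
      q , q' , q≢q' , good-q , good-q' =
        isM'p (Q.½ Q.* ι c) (x+x≤y⇒x≤½y (Q.≤-trans 2M'≤k (ι-mono-≤ (<⇒≤ k<c))))
      t , (t-prime , p∣1+t , _ , t<[1+ε]½c) , 1+c<2t =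
        distinct⇒suc-c<t+t {GoodPrimeIn p (ε₂ p r) (Q.½ Q.* ι c)} q≢q' good-q good-q' (c<t+t good-q) (c<t+t good-q')
      t≤k = pt<pk+r⇒t≤k r≤p (pt<pk+r {c = c} r≤p t<[1+ε]½c cp[1-γ]<pk+r)
      s , k≤s , s≤c , t∣C =
        BinomDiv⇒∣[cq+c]C[kq+s] p∣1+t (pk+r[1+t]≤pc r≤p (≤-trans t≤k (<⇒≤ k<c)) pk+r<c[p∸r]) div
  in ∤-[cq+c]C[kq+s]-q≤k t-prime t≤k k≤s s≤c 1+c<2t t∣C
  where
  c<t+t : ∀ {t} → GoodPrimeIn p (ε₂ p r) (Q.½ Q.* ι c) t → c < t + t
  c<t+t {t} (_ , _ , ½c<t , _) = ι-cancel-< (subst (ι c Q.<_) (sym (ι-+ t t)) (½x<y⇒x<y+y ½c<t))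

mainTheorem2 : (p r : ℕ) → Prime p → p ≢ 2 → 1 ≤ r → r ≤ p ∸ 1 →
    ((M : Q.ℚ) → IsMp p (ε₁ p r) M →
      ¬ (∃[ c ] ∃[ k ] (c ≥ 1 × k ≥ 1 × M Q.≤ ι c ×
          ι (p * k + r) Q.≤ ι (c * p) Q.* (Q.1ℚ Q.- γ p r) × BinomDiv p r c k)))
    × (2 * r ≤ p ∸ 3 → (M' : Q.ℚ) → IsM'p p (ε₂ p r) M' →
      ¬ (∃[ k ] ∃[ c ] (k ≥ 1 × c ≥ 1 × M' Q.+ M' Q.≤ ι k ×
          ι (c * p) Q.* (Q.1ℚ Q.- γ p r) Q.< ι (p * k + r) ×
          p * k + r < c * (p ∸ r) × BinomDiv p r c k)))
mainTheorem2 p r p-prime _ 1≤r r≤p∸1 =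
    (λ M isMp (c , k , _ , _ , M≤c , below , div) → ¬BinomDiv-below isMp M≤c below div)
  , (λ _ M' isM'p (k , c , _ , _ , 2M'≤k , above , pk+r<c[p∸r] , div) →
       ¬BinomDiv-above (≤-trans r≤p∸1 (m∸n≤m p 1)) isM'p 2M'≤k above pk+r<c[p∸r] div)
  where
  instance
    p≢0 : NonZero p
    p≢0 = prime⇒nonZero p-prime
    r≢0 : NonZero r
    r≢0 = >-nonZero 1≤r
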